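{- Let $n\geq 4$ and let $x_1,x_2,x_3,x_4$ be positive integers with $x_1+x_2+x_3+x_4=n$ and $x_1,x_3\geq 2$. Let $C$ be the cycle with vertices $0,1,\dots,n-1$ in this cyclic order, and put $a=0$, $b=x_1$, $c=x_1+x_2$, $d=x_1+x_2+x_3$, so that the four vertices $a,b,c,d$ split $C$ into consecutive paths of lengths $x_1$ (from $a$ to $b$), $x_2$ (from $b$ to $c$), $x_3$ (from $c$ to $d$) and $x_4$ (from $d$ to $a$). Let $G_A=C+\{a,c\}+\{b,d\}$ (two crossing chords) and $G_B=C+\{a,b\}+\{c,d\}$ (two non-crossing chords, each joining the two ends of one of the paths of lengths $x_1$ and $x_3$). Both are simple hamiltonian graphs with $n$ vertices and $m=n+2$ edges, and $$\tau(G_A)>\tau(G_B)\quad\text{and}\quad N_{m-2}(G_A)\geq N_{m-2}(G_B).$$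
   Context: For a connected graph $G=(V,E)$ with $m$ edges, the reliability polynomial is $\mathrm{Rel}(G,p)=\sum_{i=0}^m N_i p^i(1-p)^{m-i}$, where $N_i$ is the number of subsets $N\subseteq E$ with $|N|=i$ such that $(V,N)$ is connected. $\tau(G)=N_{m-n+1}$ denotes the number of spanning trees of $G$ (here $N_{m-3}$). -}

module Defs where

open import Data.Nat using (ℕ; zero; suc; _+_; _∸_; _<_; _≡ᵇ_; _<ᵇ_)
open import Data.Bool using (if_then_else_)
open import Data.Fin using (Fin; toℕ)
open import Data.Fin.Subset using (Subset; ∣_∣) renaming (_∈_ to _∈ₛ_)
open import Data.Product using (Σ; _×_; _,_)
open import Data.Sum using (_⊎_)
open import Data.List using (List; length)
open import Data.List.Relation.Unary.Unique.Propositional using (Unique)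
open import Data.List.Membership.Propositional using (_∈_)
open import Relation.Binary.PropositionalEquality using (_≡_; _≢_)
open import Relation.Nullary using (¬_)
open import Function.Bundles using (_⇔_)

-- A (multi)graph on vertex set {0,…,n-1} ⊆ ℕ with m labelled edges is given
-- by its endpoint map  Fin m → ℕ × ℕ  (edge e joins proj₁ and proj₂ of it).
EdgeMap : ℕ → Set
EdgeMap m = Fin m → ℕ × ℕ

Joins : ℕ × ℕ → ℕ → ℕ → Set
Joins (x , y) u v = (x ≡ u × y ≡ v) ⊎ (x ≡ v × y ≡ u)

data Reach {m : ℕ} (E : EdgeMap m) (S : Subset m) : ℕ → ℕ → Set where
  here : ∀ {u} → Reach E S u u
  step : ∀ {u v w} (e : Fin m) → e ∈ₛ S → Joins (E e) u v → Reach E S v w → Reach E S u w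

Connected : (n : ℕ) {m : ℕ} → EdgeMap m → Subset m → Set
Connected n E S = ∀ u v → u < n → v < n → Reach E S u v

-- "N_i(G) = k": k is the number of edge subsets S with |S| = i such that
-- (V, S) is connected; witnessed by a duplicate-free list of exactly those subsets.
IsN : (n : ℕ) {m : ℕ} → EdgeMap m → (i k : ℕ) → Set
IsN n {m} E i k =
  Σ (List (Subset m)) λ L →
    Unique L × (∀ S → (S ∈ L) ⇔ (∣ S ∣ ≡ i × Connected n E S)) × length L ≡ k

Simple : (n : ℕ) {m : ℕ} → EdgeMap m → Set
Simple n {m} E =
  (∀ e → let (x , y) = E e in x < n × y < n × x ≢ y) ×
  (∀ e e' → e ≢ e' → ¬ Joins (E e) (Data.Product.proj₁ (E e')) (Data.Product.proj₂ (E e')))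

cycNext : ℕ → ℕ → ℕ
cycNext n i = if suc i ≡ᵇ n then 0 else suc i

-- C + {p₁,q₁} + {p₂,q₂}: edges 0..n-1 are the cycle edges {i, i+1 mod n},
-- edge n is the chord {p₁,q₁}, edge n+1 is the chord {p₂,q₂}.
CycleTwoChords : (n : ℕ) → ℕ × ℕ → ℕ × ℕ → EdgeMap (n + 2)
CycleTwoChords n c₁ c₂ e =
  let i = toℕ e in
  if i <ᵇ n then (i , cycNext n i) else (if i ≡ᵇ n then c₁ else c₂)

GA : (x₁ x₂ x₃ x₄ : ℕ) → EdgeMap ((x₁ + x₂ + x₃ + x₄) + 2)
GA x₁ x₂ x₃ x₄ = CycleTwoChords (x₁ + x₂ + x₃ + x₄) (0 , x₁ + x₂) (x₁ , x₁ + x₂ + x₃)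

GB : (x₁ x₂ x₃ x₄ : ℕ) → EdgeMap ((x₁ + x₂ + x₃ + x₄) + 2)
GB x₁ x₂ x₃ x₄ = CycleTwoChords (x₁ + x₂ + x₃ + x₄) (0 , x₁) (x₁ + x₂ , x₁ + x₂ + x₃)

-- Both inequalities come from one injection on edge sets. Label the edges of GA and GB
-- alike: cycle edge k joins k and k + 1, edge n is the chord through a and edge n + 1 the
-- other chord. Let S be connected in GB. If S contains the whole b–c path, the chords ab
-- and cd of GB are walks in GA along ac, bd and that path, so S is connected in GA as it
-- stands. Otherwise S contains the whole d–a path, since missing cycle edges on both the
-- b–c and the d–a path would cut GB, whose chords each stay on one side; after
-- exchanging the two chord labels, ab and cd become walks along bd, ac and the d–a path.
-- This exchange is injective and keeps size and connectivity, so N_i(GB) ≤ N_i(GA) for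
-- all i. For i = m − 3 it misses the spanning tree of GA that omits the cycle edges
-- leaving a, b and d: a preimage would lack cycle edges on both of those paths.
module Submission where

open import Defs
open import Data.Nat using (ℕ; zero; suc; _+_; _∸_; _<_; _≤_; _≤′_; ≤′-refl; ≤′-step; _≡ᵇ_; _<ᵇ_; z≤n; s≤s; z<s)
open import Data.Nat.Properties
open import Data.Bool as Bool using (Bool; true; false; T; if_then_else_)
open import Data.Fin using (Fin; toℕ; fromℕ<)
open import Data.Fin.Properties using (toℕ<n; toℕ-fromℕ<; toℕ-injective)
open import Data.Fin.Subset using (Subset; ∣_∣; ⊤) renaming (_∈_ to _∈ₛ_)
open import Data.Fin.Subset.Properties using (∣⊤∣≡n; _∈?_)
open import Data.Product using (Σ; ∃; _×_; _,_; proj₁; proj₂)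
open import Data.Sum using (_⊎_; inj₁; inj₂)
open import Data.List using (List; []; _∷_; _++_; length; map; filter; allFin)
open import Data.List.Properties using (length-++; length-map)
open import Data.List.Relation.Unary.All as All using ([])
open import Data.List.Relation.Unary.AllPairs using ([]; _∷_)
open import Data.List.Relation.Unary.Any using (here; there)
open import Data.List.Relation.Unary.Unique.Propositional using (Unique)
import Data.List.Relation.Unary.Unique.Propositional.Properties as Unique
open import Data.List.Relation.Binary.Subset.Propositional using (_⊆_)
open import Data.List.Membership.Propositional using (_∈_; _∉_)
open import Data.List.Membership.Propositional.Properties
open import Data.Vec using (Vec; []; _∷_; lookup)
open import Data.Vec.Properties using ([]=⇒lookup; lookup⇒[]=)
open import Data.Empty using (⊥)
open import Function.Base using (_∘_)
open import Function.Bundles using (_⇔_; mk⇔; Equivalence)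
open import Function.Definitions using (Injective)
open import Relation.Binary.Definitions using (tri<; tri≈; tri>)
open import Relation.Binary.PropositionalEquality
open import Relation.Nullary using (¬_; Dec; yes; no; contradiction)
open import Relation.Nullary.Decidable using (_×-dec_; map′)

Unique-⊆⇒length≤ : {A : Set} {xs ys : List A} → Unique xs → xs ⊆ ys → length xs ≤ length ys
Unique-⊆⇒length≤ {xs = []} _ _ = z≤n
Unique-⊆⇒length≤ {xs = x ∷ xs} (x∉xs ∷ uniq) xs⊆ys with ∈-∃++ (xs⊆ys (here refl))
... | as , bs , refl = begin
  suc (length xs)              ≤⟨ s≤s (Unique-⊆⇒length≤ uniq xs⊆as++bs) ⟩
  suc (length (as ++ bs))      ≡⟨ cong suc (length-++ as) ⟩
  suc (length as + length bs)  ≡⟨ +-suc (length as) (length bs) ⟨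
  length as + length (x ∷ bs)  ≡⟨ length-++ as ⟨
  length (as ++ x ∷ bs)        ∎
  where
  open ≤-Reasoning
  xs⊆as++bs : xs ⊆ as ++ bs
  xs⊆as++bs y∈xs with ∈-++⁻ as (xs⊆ys (there y∈xs))
  ... | inj₁ y∈as          = ∈-++⁺ˡ y∈as
  ... | inj₂ (here refl)   = contradiction refl (All.lookup x∉xs y∈xs)
  ... | inj₂ (there y∈bs)  = ∈-++⁺ʳ as y∈bs

Unique-⊆-∉⇒length< : {A : Set} {xs ys : List A} {y : A} →
                     Unique xs → xs ⊆ ys → y ∈ ys → y ∉ xs → length xs < length ys
Unique-⊆-∉⇒length< {xs = xs} {ys} {y} uniq xs⊆ys y∈ys y∉xs =
  Unique-⊆⇒length≤ (All.tabulate y≢ ∷ uniq) y∷xs⊆ys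
  where
  y≢ : ∀ {x} → x ∈ xs → y ≢ x
  y≢ x∈xs refl = y∉xs x∈xs
  y∷xs⊆ys : y ∷ xs ⊆ ys
  y∷xs⊆ys (here refl)  = y∈ys
  y∷xs⊆ys (there x∈xs) = xs⊆ys x∈xs

subsets : ∀ m → List (Subset m)
subsets zero    = [] ∷ []
subsets (suc m) = map (true ∷_) (subsets m) ++ map (false ∷_) (subsets m)

∈-subsets : ∀ {m} (S : Subset m) → S ∈ subsets m
∈-subsets []                  = here refl
∈-subsets {suc m} (true ∷ S)  = ∈-++⁺ˡ (∈-map⁺ (true ∷_) (∈-subsets S))
∈-subsets {suc m} (false ∷ S) = ∈-++⁺ʳ (map (true ∷_) (subsets m)) (∈-map⁺ (false ∷_) (∈-subsets S))

subsets-unique : ∀ m → Unique (subsets m)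
subsets-unique zero    = [] ∷ []
subsets-unique (suc m) =
  Unique.++⁺ (Unique.map⁺ ∷-injectiveʳ (subsets-unique m)) (Unique.map⁺ ∷-injectiveʳ (subsets-unique m)) disjoint
  where
  ∷-injectiveʳ : ∀ {b} {S S' : Subset m} → b ∷ S ≡ b ∷ S' → S ≡ S'
  ∷-injectiveʳ refl = refl
  disjoint : ∀ {S} → S ∈ map (true ∷_) (subsets m) × S ∈ map (false ∷_) (subsets m) → ⊥
  disjoint (p , q) with ∈-map⁻ (true ∷_) p | ∈-map⁻ (false ∷_) q
  ... | _ , _ , refl | _ , _ , ()

Joins-sym : ∀ p {u v} → Joins p u v → Joins p v u
Joins-sym _ (inj₁ (x≡u , y≡v)) = inj₂ (x≡u , y≡v)
Joins-sym _ (inj₂ (x≡v , y≡u)) = inj₁ (x≡v , y≡u)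

private
  variable
    m m' : ℕ
    G : EdgeMap m
    G' : EdgeMap m'
    S : Subset m
    S' : Subset m'
    u v w : ℕ

Reach-trans : Reach G S u v → Reach G S v w → Reach G S u w
Reach-trans here                 q = q
Reach-trans (step e e∈S joins p) q = step e e∈S joins (Reach-trans p q)

Reach-edge : ∀ e → e ∈ₛ S → Reach G S (proj₁ (G e)) (proj₂ (G e))
Reach-edge e e∈S = step e e∈S (inj₁ (refl , refl)) here

Reach-sym : Reach G S u v → Reach G S v u
Reach-sym here                 = here
Reach-sym {G = G} (step e e∈S joins p) =
  Reach-trans (Reach-sym p) (step e e∈S (Joins-sym (G e) joins) here)

EdgeInvariant : (ℕ → Set) → ℕ × ℕ → Set
EdgeInvariant P p = (P (proj₁ p) → P (proj₂ p)) × (P (proj₂ p) → P (proj₁ p))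

Reach-preserves : (P : ℕ → Set) → (∀ e → e ∈ₛ S → EdgeInvariant P (G e)) → Reach G S u v → P u → P v
Reach-preserves P closed here Pu = Pu
Reach-preserves P closed (step e e∈S (inj₁ (refl , refl)) p) Pu = Reach-preserves P closed p (proj₁ (closed e e∈S) Pu)
Reach-preserves P closed (step e e∈S (inj₂ (refl , refl)) p) Pu = Reach-preserves P closed p (proj₂ (closed e e∈S) Pu)

Reach-map : (∀ e → e ∈ₛ S → Reach G' S' (proj₁ (G e)) (proj₂ (G e))) →
            Reach G S u v → Reach G' S' u v
Reach-map sim here = here
Reach-map sim (step e e∈S (inj₁ (refl , refl)) p) = Reach-trans (sim e e∈S) (Reach-map sim p)
Reach-map sim (step e e∈S (inj₂ (refl , refl)) p) = Reach-trans (Reach-sym (sim e e∈S)) (Reach-map sim p)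

Connected-map : ∀ {n} →
                (∀ e → e ∈ₛ S → Reach G' S' (proj₁ (G e)) (proj₂ (G e))) →
                Connected n G S → Connected n G' S'
Connected-map sim conn u v u<n v<n = Reach-map sim (conn u v u<n v<n)

relabel : ℕ → ℕ → ℕ → ℕ
relabel old new l with l ≟ old
... | yes _ = new
... | no  _ = l

relabel-merges : ∀ old new → relabel old new old ≡ relabel old new new
relabel-merges old new with old ≟ old | new ≟ old
... | yes _  | yes _ = refl
... | yes _  | no  _ = refl
... | no ¬eq | _     = contradiction refl ¬eq

-- Components by relabelling: each edge of S in turn merges the classes of its endpoints.
module Components {m : ℕ} (E : EdgeMap m) (S : Subset m) where

  label : List (Fin m) → ℕ → ℕ
  label []       w = w
  label (e ∷ es) w with e ∈? S
  ... | yes _ = relabel (label es (proj₁ (E e))) (label es (proj₂ (E e))) (label es w)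
  ... | no  _ = label es w

  label-edge : ∀ es e → e ∈ es → e ∈ₛ S → label es (proj₁ (E e)) ≡ label es (proj₂ (E e))
  label-edge (e ∷ es) e (here refl) e∈S with e ∈? S
  ... | yes _   = relabel-merges (label es (proj₁ (E e))) (label es (proj₂ (E e)))
  ... | no  e∉S = contradiction e∈S e∉S
  label-edge (e' ∷ es) e (there e∈es) e∈S with e' ∈? S
  ... | yes _ = cong (relabel _ _) (label-edge es e e∈es e∈S)
  ... | no  _ = label-edge es e e∈es e∈S

  relabel-sound : (c : ℕ → ℕ) (x y : ℕ) → (∀ {u v} → c u ≡ c v → Reach E S u v) → Reach E S x y →
                  ∀ {u v} → relabel (c x) (c y) (c u) ≡ relabel (c x) (c y) (c v) → Reach E S u v
  relabel-sound c x y sound x~y {u} {v} eq with c u ≟ c x | c v ≟ c x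
  ... | yes u~x | yes v~x = Reach-trans (sound u~x) (Reach-sym (sound v~x))
  ... | yes u~x | no  _   = Reach-trans (sound u~x) (Reach-trans x~y (sound eq))
  ... | no  _   | yes v~x = Reach-trans (sound eq) (Reach-trans (Reach-sym x~y) (Reach-sym (sound v~x)))
  ... | no  _   | no  _   = sound eq

  label-sound : ∀ es {u v} → label es u ≡ label es v → Reach E S u v
  label-sound []       refl = here
  label-sound (e ∷ es) eq with e ∈? S
  ... | yes e∈S = relabel-sound (label es) _ _ (label-sound es) (Reach-edge e e∈S) eq
  ... | no  _   = label-sound es eq

  component : ℕ → ℕ
  component = label (allFin m)

  Reach⇔sameComponent : ∀ u v → Reach E S u v ⇔ (component u ≡ component v)
  Reach⇔sameComponent u v = mk⇔ (λ u~v → Reach-preserves (λ w → component u ≡ component w) closed u~v refl)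
                                (label-sound (allFin m))
    where
    closed : ∀ e → e ∈ₛ S → EdgeInvariant (λ w → component u ≡ component w) (E e)
    closed e e∈S = (λ eq → trans eq (label-edge (allFin m) e (∈-allFin e) e∈S))
                 , (λ eq → trans eq (sym (label-edge (allFin m) e (∈-allFin e) e∈S)))

connected? : ∀ n {m} (E : EdgeMap m) (S : Subset m) → Dec (Connected n E S)
connected? n E S =
  map′ (λ same u v u<n v<n → from (Reach⇔sameComponent u v) (same {u} u<n {v} v<n))
       (λ conn {u} u<n {v} v<n → to (Reach⇔sameComponent u v) (conn u v u<n v<n))
       (allUpTo? (λ u → allUpTo? (λ v → component u ≟ component v) n) n)
  where
  open Components E S
  open Equivalence

module _ (n : ℕ) {m : ℕ} (E : EdgeMap m) (i : ℕ) where

  ConnectedOfSize : Subset m → Set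
  ConnectedOfSize S = ∣ S ∣ ≡ i × Connected n E S

  connectedOfSize? : ∀ S → Dec (ConnectedOfSize S)
  connectedOfSize? S = (∣ S ∣ ≟ i) ×-dec connected? n E S

  connectedSubsets : List (Subset m)
  connectedSubsets = filter connectedOfSize? (subsets m)

  ∈-connectedSubsets : ∀ S → S ∈ connectedSubsets ⇔ ConnectedOfSize S
  ∈-connectedSubsets S = mk⇔ (proj₂ ∘ ∈-filter⁻ connectedOfSize? {xs = subsets m})
                             (∈-filter⁺ connectedOfSize? (∈-subsets S))

  connectedSubsets-unique : Unique connectedSubsets
  connectedSubsets-unique = Unique.filter⁺ connectedOfSize? (subsets-unique m)

  IsN-connectedSubsets : IsN n E i (length connectedSubsets)
  IsN-connectedSubsets = connectedSubsets , connectedSubsets-unique , ∈-connectedSubsets , refl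

module _ {n n' m m' i : ℕ} {E : EdgeMap m} {E' : EdgeMap m'} (f : Subset m → Subset m')
         (f-injective : Injective _≡_ _≡_ f)
         (f-connected : ∀ S → ConnectedOfSize n E i S → ConnectedOfSize n' E' i (f S)) where

  private
    open Equivalence

    image⊆ : map f (connectedSubsets n E i) ⊆ connectedSubsets n' E' i
    image⊆ fS∈ with ∈-map⁻ f fS∈
    ... | S , S∈ , refl = from (∈-connectedSubsets n' E' i (f S)) (f-connected S (to (∈-connectedSubsets n E i S) S∈))

    image-unique : Unique (map f (connectedSubsets n E i))
    image-unique = Unique.map⁺ f-injective (connectedSubsets-unique n E i)

  connectedSubsets-length≤ : length (connectedSubsets n E i) ≤ length (connectedSubsets n' E' i)
  connectedSubsets-length≤ =
    subst (_≤ _) (length-map f (connectedSubsets n E i)) (Unique-⊆⇒length≤ image-unique image⊆)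

  connectedSubsets-length< : (T : Subset m') → ConnectedOfSize n' E' i T →
                             (∀ S → ConnectedOfSize n E i S → f S ≢ T) →
                             length (connectedSubsets n E i) < length (connectedSubsets n' E' i)
  connectedSubsets-length< T T-connected T∉image =
    subst (_< _) (length-map f (connectedSubsets n E i))
      (Unique-⊆-∉⇒length< image-unique image⊆ (from (∈-connectedSubsets n' E' i T) T-connected) T∉map)
    where
    T∉map : T ∉ map f (connectedSubsets n E i)
    T∉map T∈ with ∈-map⁻ f T∈
    ... | S , S∈ , T≡fS = T∉image S (to (∈-connectedSubsets n E i S) S∈) (sym T≡fS)

-- Edges are addressed by their ℕ index, so that cycle edge k and the chords N, N + 1 need
-- no Fin arithmetic; mem is false past the end of the vector.
mem : ∀ {m} → Subset m → ℕ → Bool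
mem []      _       = false
mem (b ∷ _) zero    = b
mem (_ ∷ S) (suc k) = mem S k

mem-toℕ : ∀ {m} (S : Subset m) e → mem S (toℕ e) ≡ lookup S e
mem-toℕ (b ∷ S) Fin.zero    = refl
mem-toℕ (b ∷ S) (Fin.suc e) = mem-toℕ S e

∈⇒mem : ∀ {m} {S : Subset m} {e} → e ∈ₛ S → mem S (toℕ e) ≡ true
∈⇒mem {S = S} {e} e∈S = trans (mem-toℕ S e) ([]=⇒lookup e∈S)

mem⇒∈ : ∀ {m} {S : Subset m} {e} → mem S (toℕ e) ≡ true → e ∈ₛ S
mem⇒∈ {S = S} {e} eq = lookup⇒[]= e S (trans (sym (mem-toℕ S e)) eq)

mem-⊤ : ∀ {m k} → k < m → mem (⊤ {m}) k ≡ true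
mem-⊤ {suc m} {zero}  _   = refl
mem-⊤ {suc m} {suc k} k<m = mem-⊤ (≤-pred k<m)

remove : ∀ {m} → Subset m → ℕ → Subset m
remove []      _       = []
remove (_ ∷ S) zero    = false ∷ S
remove (b ∷ S) (suc k) = b ∷ remove S k

mem-remove-≡ : ∀ {m} (S : Subset m) {k} → k < m → mem (remove S k) k ≡ false
mem-remove-≡ (_ ∷ S) {zero}  _   = refl
mem-remove-≡ (_ ∷ S) {suc k} k<m = mem-remove-≡ S (≤-pred k<m)

mem-remove-≢ : ∀ {m} (S : Subset m) {k j} → j ≢ k → mem (remove S k) j ≡ mem S j
mem-remove-≢ []      _                   = refl
mem-remove-≢ (_ ∷ S) {zero}  {zero}  j≢k = contradiction refl j≢k
mem-remove-≢ (_ ∷ S) {zero}  {suc j} _   = refl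
mem-remove-≢ (_ ∷ S) {suc k} {zero}  _   = refl
mem-remove-≢ (_ ∷ S) {suc k} {suc j} j≢k = mem-remove-≢ S (j≢k ∘ cong suc)

∣remove∣ : ∀ {m} (S : Subset m) {k} → mem S k ≡ true → suc ∣ remove S k ∣ ≡ ∣ S ∣
∣remove∣ (true  ∷ S) {zero}  refl = refl
∣remove∣ (true  ∷ S) {suc k} k∈S  = cong suc (∣remove∣ S k∈S)
∣remove∣ (false ∷ S) {suc k} k∈S  = ∣remove∣ S k∈S

swapLastTwo : ∀ {A : Set} N → Vec A (N + 2) → Vec A (N + 2)
swapLastTwo zero    (x ∷ y ∷ []) = y ∷ x ∷ []
swapLastTwo (suc N) (x ∷ xs)     = x ∷ swapLastTwo N xs

swapLastTwo-involutive : ∀ {A : Set} N (xs : Vec A (N + 2)) → swapLastTwo N (swapLastTwo N xs) ≡ xs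
swapLastTwo-involutive zero    (x ∷ y ∷ []) = refl
swapLastTwo-involutive (suc N) (x ∷ xs)     = cong (x ∷_) (swapLastTwo-involutive N xs)

swapLastTwo-injective : ∀ {A : Set} N → Injective _≡_ _≡_ (swapLastTwo {A} N)
swapLastTwo-injective N {xs} {ys} eq = begin
  xs                                   ≡⟨ swapLastTwo-involutive N xs ⟨
  swapLastTwo N (swapLastTwo N xs)     ≡⟨ cong (swapLastTwo N) eq ⟩
  swapLastTwo N (swapLastTwo N ys)     ≡⟨ swapLastTwo-involutive N ys ⟩
  ys                                   ∎
  where open ≡-Reasoning

mem-swapLastTwo-< : ∀ N (S : Subset (N + 2)) {k} → k < N → mem (swapLastTwo N S) k ≡ mem S k
mem-swapLastTwo-< (suc N) (_ ∷ S) {zero}  _   = refl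
mem-swapLastTwo-< (suc N) (_ ∷ S) {suc k} k<N = mem-swapLastTwo-< N S (≤-pred k<N)

mem-swapLastTwo-N : ∀ N (S : Subset (N + 2)) → mem (swapLastTwo N S) N ≡ mem S (suc N)
mem-swapLastTwo-N zero    (_ ∷ _ ∷ []) = refl
mem-swapLastTwo-N (suc N) (_ ∷ S)      = mem-swapLastTwo-N N S

mem-swapLastTwo-1+N : ∀ N (S : Subset (N + 2)) → mem (swapLastTwo N S) (suc N) ≡ mem S N
mem-swapLastTwo-1+N zero    (_ ∷ _ ∷ []) = refl
mem-swapLastTwo-1+N (suc N) (_ ∷ S)      = mem-swapLastTwo-1+N N S

mem-swapLastTwo-≡ : ∀ N {S S' : Subset (N + 2)} → swapLastTwo N S ≡ S' → ∀ {k} → k < N → mem S k ≡ mem S' k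
mem-swapLastTwo-≡ N {S} refl k<N = sym (mem-swapLastTwo-< N S k<N)

∣swapLastTwo∣ : ∀ N (S : Subset (N + 2)) → ∣ swapLastTwo N S ∣ ≡ ∣ S ∣
∣swapLastTwo∣ zero    (true  ∷ true  ∷ []) = refl
∣swapLastTwo∣ zero    (true  ∷ false ∷ []) = refl
∣swapLastTwo∣ zero    (false ∷ true  ∷ []) = refl
∣swapLastTwo∣ zero    (false ∷ false ∷ []) = refl
∣swapLastTwo∣ (suc N) (true  ∷ S)          = cong suc (∣swapLastTwo∣ N S)
∣swapLastTwo∣ (suc N) (false ∷ S)          = ∣swapLastTwo∣ N S

cycNext-< : ∀ {N k} → suc k < N → cycNext N k ≡ suc k
cycNext-< {N} {k} 1+k<N with suc k ≡ᵇ N in eq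
... | false = refl
... | true  = contradiction (≡ᵇ⇒≡ (suc k) N (subst T (sym eq) _)) (<⇒≢ 1+k<N)

cycNext-last : ∀ {N k} → suc k ≡ N → cycNext N k ≡ 0
cycNext-last {N} {k} 1+k≡N with suc k ≡ᵇ N in eq
... | true  = refl
... | false = contradiction (subst T eq (≡⇒≡ᵇ (suc k) N 1+k≡N)) (λ ())

cycNext-elim : ∀ {N} (Q : ℕ → ℕ → Set) → (∀ {k} → suc k < N → Q k (suc k)) → (∀ {k} → suc k ≡ N → Q k 0) →
               ∀ {k} → k < N → Q k (cycNext N k)
cycNext-elim Q inner last {k} k<N with m≤n⇒m<n∨m≡n k<N
... | inj₁ 1+k<N = subst (Q k) (sym (cycNext-< 1+k<N)) (inner 1+k<N)
... | inj₂ 1+k≡N = subst (Q k) (sym (cycNext-last 1+k≡N)) (last 1+k≡N)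

Arc : ∀ {m} → Subset m → ℕ → ℕ → Set
Arc S i j = ∀ k → i ≤ k → k < j → mem S k ≡ true

Arc-shrink : ∀ {m} {S : Subset m} {i i' j j'} → i ≤ i' → j' ≤ j → Arc S i j → Arc S i' j'
Arc-shrink i≤i' j'≤j arc k i'≤k k<j' = arc k (≤-trans i≤i' i'≤k) (<-≤-trans k<j' j'≤j)

Between : ℕ → ℕ → ℕ → Set
Between i j v = i < v × v ≤ j

mem-≢ : ∀ {m} (S : Subset m) {k l} → mem S k ≡ true → mem S l ≡ false → k ≢ l
mem-≢ _ k∈S l∉S refl with () ← trans (sym k∈S) l∉S

module CycleWithTwoChords (N : ℕ) (c₁ c₂ : ℕ × ℕ) where

  E : EdgeMap (N + 2)
  E = CycleTwoChords N c₁ c₂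

  -- E e reduces to endpoints (toℕ e), so every edge can be analysed through its index.
  endpoints : ℕ → ℕ × ℕ
  endpoints k = if k <ᵇ N then (k , cycNext N k) else (if k ≡ᵇ N then c₁ else c₂)

  endpoints-cycle : ∀ {k} → k < N → endpoints k ≡ (k , cycNext N k)
  endpoints-cycle {k} k<N with k <ᵇ N in eq
  ... | true  = refl
  ... | false = contradiction (subst T eq (<⇒<ᵇ k<N)) (λ ())

  endpoints-chord₁ : endpoints N ≡ c₁
  endpoints-chord₁ with N <ᵇ N in eq₁ | N ≡ᵇ N in eq₂
  ... | true  | _     = contradiction (<ᵇ⇒< N N (subst T (sym eq₁) _)) (n≮n N)
  ... | false | true  = refl
  ... | false | false = contradiction (subst T eq₂ (≡⇒≡ᵇ N N refl)) (λ ())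

  endpoints-chord₂ : endpoints (suc N) ≡ c₂
  endpoints-chord₂ with suc N <ᵇ N in eq₁ | suc N ≡ᵇ N in eq₂
  ... | true  | _     = contradiction (<ᵇ⇒< (suc N) N (subst T (sym eq₁) _)) (<-asym (n<1+n N))
  ... | false | true  = contradiction (≡ᵇ⇒≡ (suc N) N (subst T (sym eq₂) _)) (>⇒≢ (n<1+n N))
  ... | false | false = refl

  endpoints-elim : (Q : ℕ → ℕ × ℕ → Set) →
                   (∀ {k} → k < N → Q k (k , cycNext N k)) → Q N c₁ → Q (suc N) c₂ →
                   ∀ {k} → k < N + 2 → Q k (endpoints k)
  endpoints-elim Q cycle chord₁ chord₂ {k} k<N+2 with <-cmp k N
  ... | tri< k<N _ _  = subst (Q k) (sym (endpoints-cycle k<N)) (cycle k<N)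
  ... | tri≈ _ refl _ = subst (Q N) (sym endpoints-chord₁) chord₁
  ... | tri> _ _ N<k with ≤-antisym (≤-pred (subst (suc k ≤_) (+-comm N 2) k<N+2)) N<k
  ...   | refl = subst (Q (suc N)) (sym endpoints-chord₂) chord₂

  module _ {S : Subset (N + 2)} where

    Reach-endpoints : ∀ {k} → k < N + 2 → mem S k ≡ true → Reach E S (proj₁ (endpoints k)) (proj₂ (endpoints k))
    Reach-endpoints k<N+2 k∈S =
      subst (λ j → Reach E S (proj₁ (endpoints j)) (proj₂ (endpoints j))) (toℕ-fromℕ< k<N+2)
        (Reach-edge (fromℕ< k<N+2) (mem⇒∈ (trans (cong (mem S) (toℕ-fromℕ< k<N+2)) k∈S)))

    Reach-cycleEdge : ∀ {k} → k < N → mem S k ≡ true → Reach E S k (cycNext N k)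
    Reach-cycleEdge k<N k∈S = subst (λ p → Reach E S (proj₁ p) (proj₂ p)) (endpoints-cycle k<N)
                                (Reach-endpoints (<-≤-trans k<N (m≤m+n N 2)) k∈S)

    Reach-next : ∀ {k} → suc k < N → mem S k ≡ true → Reach E S k (suc k)
    Reach-next 1+k<N k∈S = subst (Reach E S _) (cycNext-< 1+k<N) (Reach-cycleEdge (<-trans (n<1+n _) 1+k<N) k∈S)

    Reach-closing : ∀ {k} → suc k ≡ N → mem S k ≡ true → Reach E S k 0
    Reach-closing 1+k≡N k∈S = subst (Reach E S _) (cycNext-last 1+k≡N) (Reach-cycleEdge (≤-reflexive 1+k≡N) k∈S)

    Reach-chord₁ : mem S N ≡ true → Reach E S (proj₁ c₁) (proj₂ c₁)
    Reach-chord₁ N∈S = subst (λ p → Reach E S (proj₁ p) (proj₂ p)) endpoints-chord₁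
                         (Reach-endpoints (m<m+n N z<s) N∈S)

    Reach-chord₂ : mem S (suc N) ≡ true → Reach E S (proj₁ c₂) (proj₂ c₂)
    Reach-chord₂ 1+N∈S = subst (λ p → Reach E S (proj₁ p) (proj₂ p)) endpoints-chord₂
                           (Reach-endpoints (subst (suc N <_) (+-comm 2 N) ≤-refl) 1+N∈S)

    Reach-arc′ : ∀ {i j} → i ≤′ j → j < N → Arc S i j → Reach E S i j
    Reach-arc′ ≤′-refl _ _ = here
    Reach-arc′ (≤′-step {j} i≤′j) 1+j<N arc =
      Reach-trans (Reach-arc′ i≤′j (<-trans (n<1+n j) 1+j<N) (Arc-shrink {S = S} ≤-refl (n≤1+n j) arc))
                  (Reach-next 1+j<N (arc j (≤′⇒≤ i≤′j) ≤-refl))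

    Reach-arc : ∀ {i j} → i ≤ j → j < N → Arc S i j → Reach E S i j
    Reach-arc i≤j = Reach-arc′ (≤⇒≤′ i≤j)

    Reach-arc-closing : ∀ {i} → i < N → Arc S i N → Reach E S i 0
    Reach-arc-closing {i} i<N arc =
      Reach-trans (Reach-arc i≤M (subst (M <_) 1+M≡N ≤-refl) (Arc-shrink {S = S} ≤-refl (n≤1+n M) arc′))
                  (Reach-closing 1+M≡N (arc′ M i≤M ≤-refl))
      where
      M = N ∸ 1
      1+M≡N : suc M ≡ N
      1+M≡N = m+[n∸m]≡n (≤-trans (s≤s z≤n) i<N)
      arc′ : Arc S i (suc M)
      arc′ = subst (Arc S i) (sym 1+M≡N) arc
      i≤M : i ≤ M
      i≤M = ≤-pred (subst (suc i ≤_) (sym 1+M≡N) i<N)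

    -- Without cycle edges i and j the cycle falls into the arc i + 1, …, j (the vertices
    -- Between i j) and the rest; if no chord crosses, i + 1 cannot reach i.
    cut : ∀ {i j} → i < j → j < N → mem S i ≡ false → mem S j ≡ false →
          EdgeInvariant (Between i j) c₁ → EdgeInvariant (Between i j) c₂ → ¬ Connected N E S
    cut {i} {j} i<j j<N i∉S j∉S inv₁ inv₂ conn =
      n≮n i (proj₁ (Reach-preserves (Between i j) invariant 1+i~i (n<1+n i , i<j)))
      where
      1+i~i : Reach E S (suc i) i
      1+i~i = conn (suc i) i (≤-<-trans i<j j<N) (<-trans i<j j<N)
      cycle : ∀ {k} → k < N → mem S k ≡ true → EdgeInvariant (Between i j) (k , cycNext N k)
      cycle {k} k<N k∈S = cycNext-elim (λ k y → k ≢ i → k ≢ j → EdgeInvariant (Between i j) (k , y))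
        (λ {k} _ k≢i k≢j → (λ (i<k , k≤j) → m<n⇒m<1+n i<k , ≤∧≢⇒< k≤j k≢j)
                         , (λ (i<1+k , 1+k≤j) → ≤∧≢⇒< (≤-pred i<1+k) (k≢i ∘ sym) , <⇒≤ 1+k≤j))
        (λ {k} 1+k≡N _ k≢j → (λ (_ , k≤j) → contradiction (≤-antisym k≤j (≤-pred (subst (j <_) (sym 1+k≡N) j<N))) k≢j)
                           , (λ ()))
        k<N (mem-≢ S k∈S i∉S) (mem-≢ S k∈S j∉S)
      invariant : ∀ e → e ∈ₛ S → EdgeInvariant (Between i j) (E e)
      invariant e e∈S = endpoints-elim (λ k p → mem S k ≡ true → EdgeInvariant (Between i j) p)
                          cycle (λ _ → inv₁) (λ _ → inv₂) (toℕ<n e) (∈⇒mem e∈S)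

cycNext-cycNext-≢ : ∀ {N k} → 2 < N → k < N → cycNext N (cycNext N k) ≢ k
cycNext-cycNext-≢ {N} {k} 2<N k<N with m≤n⇒m<n∨m≡n k<N
... | inj₂ 1+k≡N rewrite cycNext-last 1+k≡N | cycNext-< {N} {0} (<-trans (s≤s (s≤s z≤n)) 2<N) =
  λ { refl → <⇒≢ 2<N 1+k≡N }
... | inj₁ 1+k<N with m≤n⇒m<n∨m≡n 1+k<N
...   | inj₁ 2+k<N rewrite cycNext-< 1+k<N | cycNext-< 2+k<N = λ ()
...   | inj₂ 2+k≡N rewrite cycNext-< 1+k<N | cycNext-last 2+k≡N = λ { refl → <⇒≢ 2<N 2+k≡N }

module _ {N q₁ p₂ q₂ : ℕ} (2≤q₁ : 2 ≤ q₁) (1+q₁<N : suc q₁ < N)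
         (0<p₂ : 0 < p₂) (1+p₂<q₂ : suc p₂ < q₂) (q₂<N : q₂ < N) where

  open CycleWithTwoChords N (0 , q₁) (p₂ , q₂)

  private
    2<N : 2 < N
    2<N = ≤-<-trans 2≤q₁ (<-trans (n<1+n q₁) 1+q₁<N)

    1<N : 1 < N
    1<N = <-trans (n<1+n 1) 2<N

    p₂<q₂ : p₂ < q₂
    p₂<q₂ = <-trans (n<1+n p₂) 1+p₂<q₂

    Loopless : ℕ × ℕ → Set
    Loopless p = proj₁ p < N × proj₂ p < N × proj₁ p ≢ proj₂ p

    loopless : ∀ {k} → k < N + 2 → Loopless (endpoints k)
    loopless = endpoints-elim (λ _ → Loopless) cycle
                 (≤-trans (s≤s z≤n) 1<N , <-trans (n<1+n q₁) 1+q₁<N , <⇒≢ (≤-trans (s≤s z≤n) 2≤q₁))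
                 (<-trans p₂<q₂ q₂<N , q₂<N , <⇒≢ p₂<q₂)
      where
      cycle : ∀ {k} → k < N → Loopless (k , cycNext N k)
      cycle k<N = cycNext-elim (λ k y → k < N → Loopless (k , y))
        (λ {k} 1+k<N k<N → k<N , 1+k<N , <⇒≢ (n<1+n k))
        (λ {k} 1+k≡N k<N → k<N , ≤-trans (s≤s z≤n) 1<N , λ { refl → <⇒≢ 1<N 1+k≡N })
        k<N k<N

    SameEdge : ℕ × ℕ → ℕ × ℕ → Set
    SameEdge p q = Joins p (proj₁ q) (proj₂ q)

    SameEdge-sym : ∀ {p q} → SameEdge p q → SameEdge q p
    SameEdge-sym (inj₁ (refl , refl)) = inj₁ (refl , refl)
    SameEdge-sym (inj₂ (refl , refl)) = inj₂ (refl , refl)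

    cycle≢cycle : ∀ {k k'} → k' < N → k ≢ k' → ¬ SameEdge (k , cycNext N k) (k' , cycNext N k')
    cycle≢cycle _    k≢k' (inj₁ (k≡k' , _))                 = k≢k' k≡k'
    cycle≢cycle k'<N _    (inj₂ (k≡next[k'] , next[k]≡k')) =
      cycNext-cycNext-≢ 2<N k'<N (trans (cong (cycNext N) (sym k≡next[k'])) next[k]≡k')

    cycle≢chord₁ : ∀ {k} → ¬ SameEdge (k , cycNext N k) (0 , q₁)
    cycle≢chord₁ (inj₁ (refl , next0≡q₁)) = <⇒≢ 2≤q₁ (trans (sym (cycNext-< 1<N)) next0≡q₁)
    cycle≢chord₁ (inj₂ (refl , nextq₁≡0)) with () ← trans (sym (cycNext-< 1+q₁<N)) nextq₁≡0

    cycle≢chord₂ : ∀ {k} → ¬ SameEdge (k , cycNext N k) (p₂ , q₂)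
    cycle≢chord₂ (inj₁ (refl , nextp₂≡q₂)) =
      <⇒≢ 1+p₂<q₂ (trans (sym (cycNext-< (<-trans 1+p₂<q₂ q₂<N))) nextp₂≡q₂)
    cycle≢chord₂ (inj₂ (refl , nextq₂≡p₂)) =
      cycNext-elim (λ k y → p₂ < k → y ≢ p₂) (λ {k} _ p₂<k → >⇒≢ (<-trans p₂<k (n<1+n k))) (λ _ _ → <⇒≢ 0<p₂)
        q₂<N p₂<q₂ nextq₂≡p₂

    chord₁≢chord₂ : ¬ SameEdge (0 , q₁) (p₂ , q₂)
    chord₁≢chord₂ (inj₁ (0≡p₂ , _)) = <⇒≢ 0<p₂ 0≡p₂
    chord₁≢chord₂ (inj₂ (0≡q₂ , _)) = <⇒≢ (<-trans 0<p₂ p₂<q₂) 0≡q₂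

    distinct : ∀ {k k'} → k < N + 2 → k' < N + 2 → k ≢ k' → ¬ SameEdge (endpoints k) (endpoints k')
    distinct {k} {k'} k< k'< = endpoints-elim (λ k p → k ≢ k' → ¬ SameEdge p (endpoints k')) cycle chord₁ chord₂ k<
      where
      cycle : ∀ {k} → k < N → k ≢ k' → ¬ SameEdge (k , cycNext N k) (endpoints k')
      cycle {k} _ = endpoints-elim (λ k' q → k ≢ k' → ¬ SameEdge (k , cycNext N k) q)
                      (λ k'<N → cycle≢cycle k'<N) (λ _ → cycle≢chord₁) (λ _ → cycle≢chord₂) k'<
      chord₁ : N ≢ k' → ¬ SameEdge (0 , q₁) (endpoints k')
      chord₁ = endpoints-elim (λ k' q → N ≢ k' → ¬ SameEdge (0 , q₁) q)
                 (λ _ _ → cycle≢chord₁ ∘ SameEdge-sym) (λ N≢N → contradiction refl N≢N) (λ _ → chord₁≢chord₂) k'<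
      chord₂ : suc N ≢ k' → ¬ SameEdge (p₂ , q₂) (endpoints k')
      chord₂ = endpoints-elim (λ k' q → suc N ≢ k' → ¬ SameEdge (p₂ , q₂) q)
                 (λ _ _ → cycle≢chord₂ ∘ SameEdge-sym) (λ _ → chord₁≢chord₂ ∘ SameEdge-sym)
                 (λ 1+N≢1+N → contradiction refl 1+N≢1+N) k'<

  CycleTwoChords-simple : Simple N E
  CycleTwoChords-simple = (λ e → loopless (toℕ<n e))
                        , (λ e e' e≢e' → distinct (toℕ<n e) (toℕ<n e') (e≢e' ∘ toℕ-injective))

module Proposition4 (x₁ x₂ x₃ x₄ : ℕ) (2≤x₁ : 2 ≤ x₁) (1≤x₂ : 1 ≤ x₂) (2≤x₃ : 2 ≤ x₃) (1≤x₄ : 1 ≤ x₄) where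

  n c d : ℕ
  n = x₁ + x₂ + x₃ + x₄
  c = x₁ + x₂
  d = x₁ + x₂ + x₃

  module A = CycleWithTwoChords n (0 , c) (x₁ , d)
  module B = CycleWithTwoChords n (0 , x₁) (c , d)

  0<x₁ : 0 < x₁
  0<x₁ = ≤-trans (s≤s z≤n) 2≤x₁

  x₁<c : x₁ < c
  x₁<c = m<m+n x₁ 1≤x₂

  1+c<d : suc c < d
  1+c<d = subst (_≤ d) (+-comm c 2) (+-monoʳ-≤ c 2≤x₃)

  c<d : c < d
  c<d = <-trans (n<1+n c) 1+c<d

  d<n : d < n
  d<n = m<m+n d 1≤x₄

  x₁<d : x₁ < d
  x₁<d = <-trans x₁<c c<d

  x₁<n : x₁ < n
  x₁<n = <-trans x₁<d d<n

  c<n : c < n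
  c<n = <-trans c<d d<n

  GA-simple : Simple n (GA x₁ x₂ x₃ x₄)
  GA-simple = CycleTwoChords-simple (≤-trans 2≤x₁ (<⇒≤ x₁<c)) (<-trans 1+c<d d<n) 0<x₁ (≤-<-trans x₁<c c<d) d<n

  GB-simple : Simple n (GB x₁ x₂ x₃ x₄)
  GB-simple = CycleTwoChords-simple 2≤x₁ (≤-<-trans x₁<c c<n) (<-trans 0<x₁ x₁<c) 1+c<d d<n

  GB-cut : ∀ {S i j} → x₁ ≤ i → i < c → d ≤ j → j < n → mem S i ≡ false → mem S j ≡ false → ¬ Connected n B.E S
  GB-cut {i = i} {j} x₁≤i i<c d≤j j<n i∉S j∉S =
    B.cut (<-≤-trans i<c (≤-trans (<⇒≤ c<d) d≤j)) j<n i∉S j∉S outside inside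
    where
    outside : EdgeInvariant (Between i j) (0 , x₁)
    outside = (λ { (() , _) }) , (λ (i<x₁ , _) → contradiction i<x₁ (≤⇒≯ x₁≤i))
    inside : EdgeInvariant (Between i j) (c , d)
    inside = (λ _ → <-trans i<c c<d , d≤j) , (λ _ → i<c , ≤-trans (<⇒≤ c<d) d≤j)

  Gap : Subset (n + 2) → Set
  Gap S = ∃ λ k → k < c × x₁ ≤ k × mem S k ≡ false

  gap? : ∀ S → Dec (Gap S)
  gap? S = anyUpTo? (λ k → (x₁ ≤? k) ×-dec (mem S k Bool.≟ false)) c

  Gap-resp : ∀ {S S'} → (∀ {k} → k < n → mem S k ≡ mem S' k) → Gap S → Gap S'
  Gap-resp S≈S' (k , k<c , x₁≤k , k∉S) = k , k<c , x₁≤k , trans (sym (S≈S' (<-trans k<c c<n))) k∉S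

  ¬Gap⇒Arc : ∀ {S} → ¬ Gap S → Arc S x₁ c
  ¬Gap⇒Arc {S} ¬gap k x₁≤k k<c with mem S k in k∈S
  ... | true  = refl
  ... | false = contradiction (k , k<c , x₁≤k , k∈S) ¬gap

  Gap⇒Arc : ∀ {S} → Gap S → Connected n B.E S → Arc S d n
  Gap⇒Arc {S} (i , i<c , x₁≤i , i∉S) conn k d≤k k<n with mem S k in k∈S
  ... | true  = refl
  ... | false = contradiction conn (GB-cut x₁≤i i<c d≤k k<n i∉S k∈S)

  swapChords : Subset (n + 2) → Subset (n + 2)
  swapChords S with gap? S
  ... | yes _ = swapLastTwo n S
  ... | no  _ = S

  mem-swapChords-< : ∀ S {k} → k < n → mem (swapChords S) k ≡ mem S k
  mem-swapChords-< S k<n with gap? S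
  ... | yes _ = mem-swapLastTwo-< n S k<n
  ... | no  _ = refl

  ∣swapChords∣ : ∀ S → ∣ swapChords S ∣ ≡ ∣ S ∣
  ∣swapChords∣ S with gap? S
  ... | yes _ = ∣swapLastTwo∣ n S
  ... | no  _ = refl

  swapChords-injective : Injective _≡_ _≡_ swapChords
  swapChords-injective {S} {S'} eq with gap? S | gap? S'
  ... | yes _    | yes _    = swapLastTwo-injective n eq
  ... | no  _    | no  _    = eq
  ... | yes gap  | no  ¬gap = contradiction (Gap-resp {S} {S'} (mem-swapLastTwo-≡ n eq) gap) ¬gap
  ... | no  ¬gap | yes gap  = contradiction (Gap-resp {S'} {S} (mem-swapLastTwo-≡ n (sym eq)) gap) ¬gap

  simulate : ∀ {S U} → (∀ {k} → k < n → mem S k ≡ true → mem U k ≡ true) →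
             (mem S n ≡ true → Reach A.E U 0 x₁) → (mem S (suc n) ≡ true → Reach A.E U c d) →
             ∀ e → e ∈ₛ S → Reach A.E U (proj₁ (B.E e)) (proj₂ (B.E e))
  simulate {S} {U} cycle chord₁ chord₂ e e∈S =
    B.endpoints-elim (λ k p → mem S k ≡ true → Reach A.E U (proj₁ p) (proj₂ p))
      (λ k<n k∈S → A.Reach-cycleEdge k<n (cycle k<n k∈S)) chord₁ chord₂ (toℕ<n e) (∈⇒mem e∈S)

  swapChords-connected : ∀ {S} → Connected n B.E S → Connected n A.E (swapChords S)
  swapChords-connected {S} conn with gap? S
  ... | yes gap = Connected-map (simulate cycle chord₁ chord₂) conn
    where
    S′ = swapLastTwo n S
    cycle : ∀ {k} → k < n → mem S k ≡ true → mem S′ k ≡ true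
    cycle k<n k∈S = trans (mem-swapLastTwo-< n S k<n) k∈S
    d~0 : Reach A.E S′ d 0
    d~0 = A.Reach-arc-closing d<n (λ k d≤k k<n → cycle k<n (Gap⇒Arc gap conn k d≤k k<n))
    chord₁ : mem S n ≡ true → Reach A.E S′ 0 x₁
    chord₁ n∈S = Reach-sym (Reach-trans (A.Reach-chord₂ (trans (mem-swapLastTwo-1+N n S) n∈S)) d~0)
    chord₂ : mem S (suc n) ≡ true → Reach A.E S′ c d
    chord₂ 1+n∈S = Reach-sym (Reach-trans d~0 (A.Reach-chord₁ (trans (mem-swapLastTwo-N n S) 1+n∈S)))
  ... | no ¬gap = Connected-map (simulate (λ _ k∈S → k∈S) chord₁ chord₂) conn
    where
    x₁~c : Reach A.E S x₁ c
    x₁~c = A.Reach-arc (<⇒≤ x₁<c) c<n (¬Gap⇒Arc {S} ¬gap)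
    chord₁ : mem S n ≡ true → Reach A.E S 0 x₁
    chord₁ n∈S = Reach-trans (A.Reach-chord₁ n∈S) (Reach-sym x₁~c)
    chord₂ : mem S (suc n) ≡ true → Reach A.E S c d
    chord₂ 1+n∈S = Reach-trans (Reach-sym x₁~c) (A.Reach-chord₂ 1+n∈S)

  swapChords-preserves : ∀ {i} S → ConnectedOfSize n B.E i S → ConnectedOfSize n A.E i (swapChords S)
  swapChords-preserves S (size , conn) = trans (∣swapChords∣ S) size , swapChords-connected conn

  <n⇒<n+2 : ∀ {k} → k < n → k < n + 2
  <n⇒<n+2 k<n = <-≤-trans k<n (m≤m+n n 2)

  T₁ T₂ T₀ : Subset (n + 2)
  T₁ = remove ⊤ 0
  T₂ = remove T₁ x₁
  T₀ = remove T₂ d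

  mem-T₀ : ∀ {k} → k < n + 2 → k ≢ 0 → k ≢ x₁ → k ≢ d → mem T₀ k ≡ true
  mem-T₀ k<n+2 k≢0 k≢x₁ k≢d =
    trans (mem-remove-≢ T₂ k≢d) (trans (mem-remove-≢ T₁ k≢x₁) (trans (mem-remove-≢ (⊤ {n + 2}) k≢0) (mem-⊤ k<n+2)))

  x₁∉T₀ : mem T₀ x₁ ≡ false
  x₁∉T₀ = trans (mem-remove-≢ T₂ (<⇒≢ x₁<d)) (mem-remove-≡ T₁ (<n⇒<n+2 x₁<n))

  d∉T₀ : mem T₀ d ≡ false
  d∉T₀ = mem-remove-≡ T₂ (<n⇒<n+2 d<n)

  ∣T₀∣ : ∣ T₀ ∣ ≡ n + 2 ∸ 3
  ∣T₀∣ = begin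
    ∣ T₀ ∣                  ≡⟨ m+n∸m≡n 3 ∣ T₀ ∣ ⟨
    3 + ∣ T₀ ∣ ∸ 3          ≡⟨ cong (λ k → 2 + k ∸ 3) (∣remove∣ T₂ d∈T₂) ⟩
    2 + ∣ T₂ ∣ ∸ 3          ≡⟨ cong (λ k → 1 + k ∸ 3) (∣remove∣ T₁ x₁∈T₁) ⟩
    1 + ∣ T₁ ∣ ∸ 3          ≡⟨ cong (_∸ 3) (∣remove∣ (⊤ {n + 2}) (mem-⊤ (<n⇒<n+2 (<-trans 0<x₁ x₁<n)))) ⟩
    ∣ ⊤ {n + 2} ∣ ∸ 3       ≡⟨ cong (_∸ 3) (∣⊤∣≡n (n + 2)) ⟩
    n + 2 ∸ 3               ∎
    where
    open ≡-Reasoning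
    x₁∈T₁ : mem T₁ x₁ ≡ true
    x₁∈T₁ = trans (mem-remove-≢ (⊤ {n + 2}) (>⇒≢ 0<x₁)) (mem-⊤ (<n⇒<n+2 x₁<n))
    d∈T₂ : mem T₂ d ≡ true
    d∈T₂ = trans (mem-remove-≢ T₁ (>⇒≢ x₁<d)) (trans (mem-remove-≢ (⊤ {n + 2}) (>⇒≢ (<-trans 0<x₁ x₁<d))) (mem-⊤ (<n⇒<n+2 d<n)))

  ≢-outside : ∀ {x i j k} → i ≤ k → k < j → j ≤ x ⊎ x < i → k ≢ x
  ≢-outside _   k<j (inj₁ j≤x) = <⇒≢ (<-≤-trans k<j j≤x)
  ≢-outside i≤k _   (inj₂ x<i) = >⇒≢ (<-≤-trans x<i i≤k)

  Arc-T₀ : ∀ {i j} → 0 < i → j ≤ n → j ≤ x₁ ⊎ x₁ < i → j ≤ d ⊎ d < i → Arc T₀ i j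
  Arc-T₀ 0<i j≤n x₁∉ d∉ k i≤k k<j =
    mem-T₀ (<n⇒<n+2 (<-≤-trans k<j j≤n)) (≢-outside i≤k k<j (inj₂ 0<i)) (≢-outside i≤k k<j x₁∉) (≢-outside i≤k k<j d∉)

  T₀-connected : Connected n A.E T₀
  T₀-connected u v u<n v<n = Reach-trans (toRoot u<n) (Reach-sym (toRoot v<n))
    where
    c~0 : Reach A.E T₀ c 0
    c~0 = Reach-sym (A.Reach-chord₁ (mem-T₀ (m<m+n n z<s) (>⇒≢ (<-trans 0<x₁ x₁<n)) (>⇒≢ x₁<n) (>⇒≢ d<n)))
    d~0 : Reach A.E T₀ d 0
    d~0 = Reach-trans (Reach-sym (A.Reach-arc (<⇒≤ c<d) d<n (Arc-T₀ (<-trans 0<x₁ x₁<c) (<⇒≤ d<n) (inj₂ x₁<c) (inj₁ ≤-refl)))) c~0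
    x₁~0 : Reach A.E T₀ x₁ 0
    x₁~0 = Reach-trans (A.Reach-chord₂ (mem-T₀ (subst (suc n <_) (+-comm 2 n) ≤-refl)
                                         (λ ()) (>⇒≢ (<-trans x₁<n (n<1+n n))) (>⇒≢ (<-trans d<n (n<1+n n)))))
                       d~0
    toRoot : ∀ {v} → v < n → Reach A.E T₀ v 0
    toRoot {zero}  _     = here
    toRoot {suc v} 1+v<n with suc v ≤? x₁ | suc v ≤? d
    ... | yes 1+v≤x₁ | _          = Reach-trans (A.Reach-arc 1+v≤x₁ x₁<n (Arc-T₀ z<s (<⇒≤ x₁<n) (inj₁ ≤-refl) (inj₁ (<⇒≤ x₁<d)))) x₁~0
    ... | no  1+v≰x₁ | yes 1+v≤d = Reach-trans (A.Reach-arc 1+v≤d d<n (Arc-T₀ z<s (<⇒≤ d<n) (inj₂ (≰⇒> 1+v≰x₁)) (inj₁ ≤-refl))) d~0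
    ... | no  1+v≰x₁ | no  1+v≰d = A.Reach-arc-closing 1+v<n (Arc-T₀ z<s ≤-refl (inj₂ (≰⇒> 1+v≰x₁)) (inj₂ (≰⇒> 1+v≰d)))

  T₀-not-swapped : ∀ {i} S → ConnectedOfSize n B.E i S → swapChords S ≢ T₀
  T₀-not-swapped S (_ , conn) S↦T₀ = GB-cut ≤-refl x₁<c ≤-refl d<n (∉T₀⇒∉S x₁<n x₁∉T₀) (∉T₀⇒∉S d<n d∉T₀) conn
    where
    ∉T₀⇒∉S : ∀ {k} → k < n → mem T₀ k ≡ false → mem S k ≡ false
    ∉T₀⇒∉S {k} k<n k∉T₀ = trans (sym (mem-swapChords-< S k<n)) (trans (cong (λ X → mem X k) S↦T₀) k∉T₀)

proposition4 : (x₁ x₂ x₃ x₄ : ℕ) →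
    1 ≤ x₁ → 1 ≤ x₂ → 1 ≤ x₃ → 1 ≤ x₄ → 2 ≤ x₁ → 2 ≤ x₃ →
    4 ≤ x₁ + x₂ + x₃ + x₄ →
    Simple (x₁ + x₂ + x₃ + x₄) (GA x₁ x₂ x₃ x₄) ×
    Simple (x₁ + x₂ + x₃ + x₄) (GB x₁ x₂ x₃ x₄) ×
    Σ ℕ (λ τA → Σ ℕ (λ τB →
      IsN (x₁ + x₂ + x₃ + x₄) (GA x₁ x₂ x₃ x₄) ((x₁ + x₂ + x₃ + x₄ + 2) ∸ 3) τA ×
      IsN (x₁ + x₂ + x₃ + x₄) (GB x₁ x₂ x₃ x₄) ((x₁ + x₂ + x₃ + x₄ + 2) ∸ 3) τB ×
      τB < τA)) ×
    Σ ℕ (λ NA → Σ ℕ (λ NB →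
      IsN (x₁ + x₂ + x₃ + x₄) (GA x₁ x₂ x₃ x₄) ((x₁ + x₂ + x₃ + x₄ + 2) ∸ 2) NA ×
      IsN (x₁ + x₂ + x₃ + x₄) (GB x₁ x₂ x₃ x₄) ((x₁ + x₂ + x₃ + x₄ + 2) ∸ 2) NB ×
      NB ≤ NA))
-- The hypotheses 1 ≤ x₁, 1 ≤ x₃ and 4 ≤ n follow from the others.
proposition4 x₁ x₂ x₃ x₄ _ 1≤x₂ _ 1≤x₄ 2≤x₁ 2≤x₃ _ =
  GA-simple , GB-simple ,
  (_ , _ , IsN-connectedSubsets n A.E (n + 2 ∸ 3) , IsN-connectedSubsets n B.E (n + 2 ∸ 3) ,
   connectedSubsets-length< swapChords swapChords-injective swapChords-preserves T₀ (∣T₀∣ , T₀-connected) T₀-not-swapped) ,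
  (_ , _ , IsN-connectedSubsets n A.E (n + 2 ∸ 2) , IsN-connectedSubsets n B.E (n + 2 ∸ 2) ,
   connectedSubsets-length≤ swapChords swapChords-injective swapChords-preserves)
  where open Proposition4 x₁ x₂ x₃ x₄ 2≤x₁ 1≤x₂ 2≤x₃ 1≤x₄
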